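{- Let $G_1$ be a finite group written additively with $|G_1|=v$, $H$ a subgroup of $G_1$ with $|H|=h$, and $k\ge2$. If there exists a $(G_1,H,k,1)$-BRDF and a nested $(h,k,1)$-BIBD, then there exists a nested $(v,k,1)$-BIBD.
   Context: A $(G,H,k,\lambda)$-RDF (for $G$ a finite additive group, $H$ a subgroup) is a set $\mathcal{F}$ of $k$-subsets of $G$ (base blocks) such that the multiset of differences $x-y$, over ordered pairs of distinct elements $x,y$ in a common base block, contains each element of $G\setminus H$ exactly $\lambda$ times and no element of $H$. A $(G,H,k,\lambda)$-BRDF is such an RDF with every base block disjoint from $H$ and the sets $B$, $-B=\{ -b:b\in B\}$ ($B\in\mathcal{F}$) pairwise disjoint (including $B\cap-B=\emptyset$). A $(v,k,\lambda)$-BIBD is a pair $(X,\mathcal{A})$ with $|X|=v$ and $\mathcal{A}$ a collection of $k$-subsets (blocks) such that every pair of distinct points lies in exactly $\lambda$ blocks; a partial one has "at most $\lambda$". A nested $(v,k,\lambda)$-BIBD is a $(v,k,\lambda)$-BIBD $(X,\mathcal{A})$ together with a map $\phi:\mathcal{A}\to X$ such that $(X,\{A\cup\{\phi(A)\}:A\in\mathcal{A}\})$ is a partial $(v,k+1,\lambda+1)$-BIBD (augmented blocks of size $k+1$). -}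

module Defs where

open import Data.Nat using (ℕ; zero; suc; _≤_)
open import Data.Bool using (Bool; true; false; _∧_; not; if_then_else_)
open import Data.Fin using (Fin; _≟_)
open import Data.Fin.Subset using (Subset; _∈_; _∉_; ∣_∣; _∩_; _∪_; ⁅_⁆; Empty)
open import Data.Vec using (lookup; tabulate)
open import Data.Nat.ListAction using (sum)
open import Data.List using (List; _∷_; []; map; length; concatMap; allFin)
import Data.List as L
open import Data.List.Relation.Unary.All using (All)
open import Data.Product using (_×_; proj₁; proj₂; Σ; ∃)
open import Relation.Binary.PropositionalEquality using (_≡_; _≢_)
open import Relation.Nullary.Decidable using (⌊_⌋)
open import Algebra.Structures using (IsAbelianGroup)

record FinAbGroup (v : ℕ) : Set where
  field
    _+_ : Fin v → Fin v → Fin v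
    0#  : Fin v
    -_  : Fin v → Fin v
    isAbelianGroup : IsAbelianGroup _≡_ _+_ 0# -_

  _-_ : Fin v → Fin v → Fin v
  x - y = x + (- y)

  infixl 6 _+_ _-_
  infix 8 -_

open FinAbGroup public

record IsSubgroup {v : ℕ} (G : FinAbGroup v) (H : Subset v) : Set where
  field
    zero-∈ : 0# G ∈ H
    +-closed : ∀ {x y} → x ∈ H → y ∈ H → _+_ G x y ∈ H
    neg-closed : ∀ {x} → x ∈ H → -_ G x ∈ H

IsKSubset : {v : ℕ} → ℕ → Subset v → Set
IsKSubset k B = ∣ B ∣ ≡ k

eqᵇ : {v : ℕ} → Fin v → Fin v → Bool
eqᵇ x y = ⌊ x ≟ y ⌋

diffCountBlock : {v : ℕ} → FinAbGroup v → Subset v → Fin v → ℕ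
diffCountBlock {v} G B g =
  sum (map (λ x → ∣ tabulate (λ y → lookup B x ∧ lookup B y ∧ not (eqᵇ x y)
                                     ∧ eqᵇ (_-_ G x y) g) ∣) (allFin v))

-- multiplicity of g in the multiset of differences of the family F
diffCount : {v : ℕ} → FinAbGroup v → List (Subset v) → Fin v → ℕ
diffCount G F g = sum (map (λ B → diffCountBlock G B g) F)

IsRDF : {v : ℕ} → FinAbGroup v → Subset v → ℕ → ℕ → List (Subset v) → Set
IsRDF G H k λ' F =
  All (IsKSubset k) F ×
  (∀ g → (g ∈ H → diffCount G F g ≡ 0) × (g ∉ H → diffCount G F g ≡ λ'))

negSet : {v : ℕ} → FinAbGroup v → Subset v → Subset v
negSet G B = tabulate (λ x → lookup B (-_ G x))

IsBRDF : {v : ℕ} → FinAbGroup v → Subset v → ℕ → ℕ → List (Subset v) → Set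
IsBRDF G H k λ' F =
  IsRDF G H k λ' F ×
  All (λ B → Empty (B ∩ H)) F ×
  (let Ls = concatMap (λ B → B ∷ negSet G B ∷ []) F in
   ∀ (i j : Fin (length Ls)) → i ≢ j → Empty (L.lookup Ls i ∩ L.lookup Ls j))

pairCount : {v : ℕ} → List (Subset v) → Fin v → Fin v → ℕ
pairCount A x y = sum (map (λ B → if lookup B x ∧ lookup B y then 1 else 0) A)

IsBIBD : (v k λ' : ℕ) → List (Subset v) → Set
IsBIBD v k λ' A = All (IsKSubset k) A × (∀ x y → x ≢ y → pairCount A x y ≡ λ')

IsPartialBIBD : (v k λ' : ℕ) → List (Subset v) → Set
IsPartialBIBD v k λ' A = All (IsKSubset k) A × (∀ x y → x ≢ y → pairCount A x y ≤ λ')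

-- nested (v,k,λ)-BIBD: blocks A paired with φ(A)
NestedBIBD : (v k λ' : ℕ) → Set
NestedBIBD v k λ' =
  Σ (List (Subset v × Fin v)) λ Aφ →
    IsBIBD v k λ' (map proj₁ Aφ) ×
    IsPartialBIBD v (suc k) (suc λ') (map (λ p → proj₁ p ∪ ⁅ proj₂ p ⁆) Aφ)

{-# OPTIONS --safe #-}

-- Take the translates B + g of the base blocks (B ∈ F, g ∈ G), nesting B + g with the point g, together with
-- a copy x + A of each block A of the nested design on H, nested with x + φ(A), for one representative x of
-- every coset of H. Since F is a (G, H, k, 1)-difference family, a pair {x, y} with x − y ∉ H lies in exactly
-- one translate and in no coset copy, while a pair with x − y ∈ H lies in no translate and in exactly one
-- coset copy. The augmented translate (B + g) ∪ {g} is the translate of B ∪ {0}, a (k + 1)-set because B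
-- avoids H ∋ 0; its differences are those of B together with ±b for b ∈ B. The sets B and −B are pairwise
-- disjoint and avoid H, so an augmented pair is covered at most 1 + 1 times if x − y ∉ H and at most 0 + 2
-- times if x − y ∈ H.

module Submission where

open import Algebra.Bundles using (AbelianGroup)
open import Data.Bool using (Bool; true; false; _∧_; _∨_; not; if_then_else_)
open import Data.Bool.Properties using (if-float; ∧-zeroʳ; ∧-identityʳ)
open import Data.Fin using (Fin; zero; suc; punchIn; _≟_)
open import Data.Fin.Permutation using (permutation)
open import Data.Fin.Properties using (punchInᵢ≢i; suc-injective)
open import Data.Fin.Subset using (Subset; ∣_∣; _∈_; _∉_; _∪_; _∩_; ⁅_⁆; ⊥; Empty)
open import Data.Fin.Subset.Properties using (∪-identityʳ; x∈p∩q⁺; _∈?_)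
open import Data.List as List using (List; _++_; map; concatMap)
open import Data.List.Properties using (map-++; map-∘; map-cong; map-id; map-concatMap; concatMap-cong)
open import Data.List.Relation.Unary.All as All using (All; []; _∷_)
open import Data.List.Relation.Unary.All.Properties using (concat⁺; map⁺; tabulate⁺; ++⁺)
open import Data.Maybe as Maybe using (Maybe; just; nothing)
open import Data.Maybe.Properties using (just-injective)
open import Data.Nat using (ℕ; zero; suc; _+_; _≤_; z≤n; s≤s)
open import Data.Nat.ListAction using (sum)
open import Data.Nat.ListAction.Properties using (sum-++)
open import Data.Nat.Properties
  using (module ≤-Reasoning; +-0-commutativeMonoid; +-commutativeSemigroup; +-identityʳ; +-mono-≤; ≤-refl; ≤-reflexive)
open import Data.Product using (Σ; ∃; ∃₂; _,_; _×_; proj₁; proj₂)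
open import Data.Sum using (_⊎_; inj₁; inj₂)
open import Data.Vec using ([]; _∷_; here; there; lookup; tabulate)
open import Data.Vec.Properties
  using (lookup-replicate; lookup∘tabulate; lookup⇒[]=; []=⇒lookup; tabulate-cong; tabulate∘lookup; lookup-zipWith)
open import Function using (_∘_)
open import Function.Bundles using (_⇔_; mk⇔; Equivalence)
open import Level using (Level; 0ℓ)
open import Relation.Binary.PropositionalEquality
open import Relation.Nullary using (contradiction; yes; no)
open import Relation.Nullary.Decidable using (isYes; does; isYes≗does; dec-true; dec-false; does-⇔)
open import Relation.Unary using (Pred; Decidable)

open import Algebra.Properties.CommutativeMonoid.Sum +-0-commutativeMonoid
  using (sum-syntax; sum-cong-≗; ∑-distrib-+; sum-permute; sum-remove; sum-replicate-zero)
  renaming (sum to ∑)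
open import Algebra.Properties.CommutativeSemigroup +-commutativeSemigroup using (interchange)

open import Defs
  using ( FinAbGroup; IsSubgroup; IsKSubset; IsRDF; IsBRDF; IsBIBD; IsPartialBIBD; NestedBIBD
        ; eqᵇ; diffCountBlock; diffCount; pairCount; negSet)
open List.List

private variable
  ℓ ℓ′ : Level
  A B C D : Set ℓ
  m n : ℕ

χ : Bool → ℕ
χ b = if b then 1 else 0

∑-mono : {f g : Fin n → ℕ} → (∀ i → f i ≤ g i) → ∑ f ≤ ∑ g
∑-mono {zero}  f≤g = z≤n
∑-mono {suc n} f≤g = +-mono-≤ (f≤g zero) (∑-mono (f≤g ∘ suc))

∑-zero : {f : Fin n → ℕ} → (∀ i → f i ≡ 0) → ∑ f ≡ 0
∑-zero {n} f≗0 = trans (sum-cong-≗ f≗0) (sum-replicate-zero n)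

∑-single : {f : Fin n → ℕ} (i : Fin n) → (∀ j → j ≢ i → f j ≡ 0) → ∑ f ≡ f i
∑-single {suc n} {f} i vanish = begin
  ∑ f                               ≡⟨ sum-remove {i = i} f ⟩
  f i + ∑ (f ∘ punchIn i)           ≡⟨ cong (f i +_) (∑-zero (λ j → vanish _ (punchInᵢ≢i i j))) ⟩
  f i + 0                           ≡⟨ +-identityʳ (f i) ⟩
  f i                               ∎
  where open ≡-Reasoning

∑-reindex : (f : Fin n → ℕ) (σ τ : Fin n → Fin n) → (∀ i → σ (τ i) ≡ i) → (∀ i → τ (σ i) ≡ i) →
            ∑ (f ∘ σ) ≡ ∑ f
∑-reindex f σ τ στ τσ = sym (sum-permute f (permutation σ τ στ τσ))

∑ˡ : List A → (A → ℕ) → ℕ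
∑ˡ xs f = sum (map f xs)

∑ˡ-cong : (xs : List A) {f g : A → ℕ} → (∀ x → f x ≡ g x) → ∑ˡ xs f ≡ ∑ˡ xs g
∑ˡ-cong xs f≗g = cong sum (map-cong f≗g xs)

∑ˡ-mono : (xs : List A) {f g : A → ℕ} → (∀ x → f x ≤ g x) → ∑ˡ xs f ≤ ∑ˡ xs g
∑ˡ-mono []       f≤g = z≤n
∑ˡ-mono (x ∷ xs) f≤g = +-mono-≤ (f≤g x) (∑ˡ-mono xs f≤g)

∑ˡ-zero : {xs : List A} {f : A → ℕ} → All (λ x → f x ≡ 0) xs → ∑ˡ xs f ≡ 0
∑ˡ-zero []              = refl
∑ˡ-zero (fx≡0 ∷ fxs≡0) = cong₂ _+_ fx≡0 (∑ˡ-zero fxs≡0)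

∑ˡ-map : (g : B → A) (xs : List B) (f : A → ℕ) → ∑ˡ (map g xs) f ≡ ∑ˡ xs (f ∘ g)
∑ˡ-map g xs f = cong sum (sym (map-∘ xs))

∑ˡ-++ : (xs ys : List A) (f : A → ℕ) → ∑ˡ (xs ++ ys) f ≡ ∑ˡ xs f + ∑ˡ ys f
∑ˡ-++ xs ys f = trans (cong sum (map-++ f xs ys)) (sum-++ (map f xs) (map f ys))

∑ˡ-concatMap : (g : B → List A) (xs : List B) (f : A → ℕ) →
               ∑ˡ (concatMap g xs) f ≡ ∑ˡ xs (λ x → ∑ˡ (g x) f)
∑ˡ-concatMap g []       f = refl
∑ˡ-concatMap g (x ∷ xs) f = trans (∑ˡ-++ (g x) (concatMap g xs) f) (cong (∑ˡ (g x) f +_) (∑ˡ-concatMap g xs f))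

∑ˡ-tabulate : (h : Fin n → A) (f : A → ℕ) → ∑ˡ (List.tabulate h) f ≡ ∑ (f ∘ h)
∑ˡ-tabulate {n = zero}  h f = refl
∑ˡ-tabulate {n = suc n} h f = cong (f (h zero) +_) (∑ˡ-tabulate (h ∘ suc) f)

∑ˡ-+ : (xs : List A) (f g : A → ℕ) → ∑ˡ xs (λ x → f x + g x) ≡ ∑ˡ xs f + ∑ˡ xs g
∑ˡ-+ [] f g = refl
∑ˡ-+ (x ∷ xs) f g = trans (cong (f x + g x +_) (∑ˡ-+ xs f g)) (interchange (f x) (g x) (∑ˡ xs f) (∑ˡ xs g))

∑ˡ-∑ : (xs : List A) (f : A → Fin n → ℕ) → ∑ˡ xs (λ x → ∑ (f x)) ≡ ∑ (λ i → ∑ˡ xs (λ x → f x i))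
∑ˡ-∑ {n = n} []       f = sym (∑-zero {n} λ _ → refl)
∑ˡ-∑         (x ∷ xs) f = trans (cong (∑ (f x) +_) (∑ˡ-∑ xs f)) (sym (∑-distrib-+ (f x) _))

eqᵇ-refl : (x : Fin n) → eqᵇ x x ≡ true
eqᵇ-refl x = trans (isYes≗does (x ≟ x)) (dec-true (x ≟ x) refl)

eqᵇ-≢ : {x y : Fin n} → x ≢ y → eqᵇ x y ≡ false
eqᵇ-≢ {x = x} {y} x≢y = trans (isYes≗does (x ≟ y)) (dec-false (x ≟ y) x≢y)

eqᵇ-cong : {x y : Fin m} {x′ y′ : Fin n} → (x ≡ y ⇔ x′ ≡ y′) → eqᵇ x y ≡ eqᵇ x′ y′
eqᵇ-cong {x = x} {y} {x′} {y′} x≡y⇔x′≡y′ = begin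
  isYes (x ≟ y)    ≡⟨ isYes≗does (x ≟ y) ⟩
  does (x ≟ y)     ≡⟨ does-⇔ x≡y⇔x′≡y′ (x ≟ y) (x′ ≟ y′) ⟩
  does (x′ ≟ y′)   ≡⟨ isYes≗does (x′ ≟ y′) ⟨
  isYes (x′ ≟ y′)  ∎
  where open ≡-Reasoning

χ-∨∧∨≤ : ∀ p q u w → u ∧ w ≡ false → χ ((p ∨ u) ∧ (q ∨ w)) ≤ χ (p ∧ q) + (χ (w ∧ p) + χ (u ∧ q))
χ-∨∧∨≤ true  true  u     w     _ = s≤s z≤n
χ-∨∧∨≤ true  false u     false _ = z≤n
χ-∨∧∨≤ true  false u     true  _ = s≤s z≤n
χ-∨∧∨≤ false true  false w     _ = z≤n
χ-∨∧∨≤ false true  true  false _ = s≤s z≤n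
χ-∨∧∨≤ false false false w     _ = z≤n
χ-∨∧∨≤ false false true  false _ = z≤n

∑-χ-eqᵇ-∧ : (y : Fin n) (P : Fin n → Bool) → ∑[ x < n ] χ (eqᵇ x y ∧ P x) ≡ χ (P y)
∑-χ-eqᵇ-∧ y P = trans (∑-single y (λ x x≢y → cong (λ b → χ (b ∧ P x)) (eqᵇ-≢ x≢y)))
                      (cong (λ b → χ (b ∧ P y)) (eqᵇ-refl y))

lookup-⁅⁆ : (x y : Fin n) → lookup ⁅ y ⁆ x ≡ eqᵇ x y
lookup-⁅⁆ zero    zero    = refl
lookup-⁅⁆ (suc x) zero    = lookup-replicate x false
lookup-⁅⁆ zero    (suc y) = refl
lookup-⁅⁆ (suc x) (suc y) = trans (lookup-⁅⁆ x y) (eqᵇ-cong (mk⇔ (cong suc) suc-injective))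

∉⇒lookup≡false : {x : Fin n} {p : Subset n} → x ∉ p → lookup p x ≡ false
∉⇒lookup≡false {x = x} {p} x∉p with lookup p x in eq
... | true  = contradiction (lookup⇒[]= x p eq) x∉p
... | false = refl

∣p∣≡∑χ : (p : Subset n) → ∣ p ∣ ≡ ∑ (χ ∘ lookup p)
∣p∣≡∑χ []          = refl
∣p∣≡∑χ (true ∷ p)  = cong suc (∣p∣≡∑χ p)
∣p∣≡∑χ (false ∷ p) = ∣p∣≡∑χ p

∣tabulate∣≡∑χ : (f : Fin n → Bool) → ∣ tabulate f ∣ ≡ ∑ (χ ∘ f)
∣tabulate∣≡∑χ f = trans (∣p∣≡∑χ (tabulate f)) (sum-cong-≗ (cong χ ∘ lookup∘tabulate f))

x∉p⇒∣p∪⁅x⁆∣≡1+∣p∣ : {x : Fin n} (p : Subset n) → x ∉ p → ∣ p ∪ ⁅ x ⁆ ∣ ≡ suc ∣ p ∣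
x∉p⇒∣p∪⁅x⁆∣≡1+∣p∣ {x = zero}  (true ∷ p)  x∉p = contradiction here x∉p
x∉p⇒∣p∪⁅x⁆∣≡1+∣p∣ {x = zero}  (false ∷ p) x∉p = cong (λ q → suc ∣ q ∣) (∪-identityʳ p)
x∉p⇒∣p∪⁅x⁆∣≡1+∣p∣ {x = suc x} (true ∷ p)  x∉p = cong suc (x∉p⇒∣p∪⁅x⁆∣≡1+∣p∣ p (x∉p ∘ there))
x∉p⇒∣p∪⁅x⁆∣≡1+∣p∣ {x = suc x} (false ∷ p) x∉p = x∉p⇒∣p∪⁅x⁆∣≡1+∣p∣ p (x∉p ∘ there)

occurrences : Fin n → List (Subset n) → ℕ
occurrences x Ls = ∑ˡ Ls (λ L → χ (lookup L x))

PairwiseDisjoint : List (Subset n) → Set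
PairwiseDisjoint Ls = ∀ i j → i ≢ j → Empty (List.lookup Ls i ∩ List.lookup Ls j)

occurrences-absent : (Ls : List (Subset n)) {x : Fin n} → (∀ i → x ∉ List.lookup Ls i) → occurrences x Ls ≡ 0
occurrences-absent []       x∉ = refl
occurrences-absent (L ∷ Ls) x∉ = cong₂ _+_ (cong χ (∉⇒lookup≡false (x∉ zero))) (occurrences-absent Ls (x∉ ∘ suc))

occurrences-disjoint : (Ls : List (Subset n)) → PairwiseDisjoint Ls → (x : Fin n) → occurrences x Ls ≤ 1
occurrences-disjoint []       disjoint x = z≤n
occurrences-disjoint (L ∷ Ls) disjoint x with lookup L x in x∈L
... | false = occurrences-disjoint Ls (λ i j i≢j → disjoint (suc i) (suc j) (i≢j ∘ suc-injective)) x
... | true  = s≤s (≤-reflexive (occurrences-absent Ls λ i x∈Lᵢ →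
                  disjoint zero (suc i) (λ ()) (x , x∈p∩q⁺ (lookup⇒[]= x L x∈L , x∈Lᵢ))))

first : {P : Pred (Fin n) ℓ′} → Decidable P → Maybe (Fin n)
first {n = zero}  P? = nothing
first {n = suc n} P? with P? zero
... | yes _ = just zero
... | no  _ = Maybe.map suc (first (P? ∘ suc))

first-sound : {P : Pred (Fin n) ℓ′} (P? : Decidable P) {x : Fin n} → first P? ≡ just x → P x
first-sound {n = suc n} P? eq with P? zero
first-sound {n = suc n} P? refl | yes P0 = P0
... | no _ with first (P? ∘ suc) in eq′
first-sound {n = suc n} P? refl | no _ | just y = first-sound (P? ∘ suc) eq′

first-complete : {P : Pred (Fin n) ℓ′} (P? : Decidable P) {x : Fin n} → P x → ∃ λ y → first P? ≡ just y
first-complete {n = suc n} P? {x} Px with P? zero | x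
... | yes _   | _     = zero , refl
... | no ¬P0  | zero  = contradiction Px ¬P0
... | no _    | suc x with first-complete (P? ∘ suc) Px
...   | y , eq = suc y , cong (Maybe.map suc) eq

first-cong : {P Q : Pred (Fin n) ℓ′} (P? : Decidable P) (Q? : Decidable Q) →
             (∀ x → P x ⇔ Q x) → first P? ≡ first Q?
first-cong {n = zero}  P? Q? P⇔Q = refl
first-cong {n = suc n} P? Q? P⇔Q with P? zero | Q? zero
... | yes _  | yes _  = refl
... | no _   | no _   = cong (Maybe.map suc) (first-cong (P? ∘ suc) (Q? ∘ suc) (P⇔Q ∘ suc))
... | yes P0 | no ¬Q0 = contradiction (Equivalence.to (P⇔Q zero) P0) ¬Q0
... | no ¬P0 | yes Q0 = contradiction (Equivalence.from (P⇔Q zero) Q0) ¬P0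

-- A subset p as the point set Fin ∣ p ∣

ι : (p : Subset n) → Fin ∣ p ∣ → Fin n
ι (true ∷ p)  zero    = zero
ι (true ∷ p)  (suc a) = suc (ι p a)
ι (false ∷ p) a       = suc (ι p a)

embed : (p : Subset n) → Subset ∣ p ∣ → Subset n
embed []          []      = []
embed (true ∷ p)  (b ∷ A) = b ∷ embed p A
embed (false ∷ p) A       = false ∷ embed p A

∣embed∣ : (p : Subset n) (A : Subset ∣ p ∣) → ∣ embed p A ∣ ≡ ∣ A ∣
∣embed∣ []          []          = refl
∣embed∣ (true ∷ p)  (true ∷ A)  = cong suc (∣embed∣ p A)
∣embed∣ (true ∷ p)  (false ∷ A) = ∣embed∣ p A
∣embed∣ (false ∷ p) A           = ∣embed∣ p A

lookup-embed-ι : (p : Subset n) (A : Subset ∣ p ∣) (a : Fin ∣ p ∣) → lookup (embed p A) (ι p a) ≡ lookup A a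
lookup-embed-ι (true ∷ p)  (b ∷ A) zero    = refl
lookup-embed-ι (true ∷ p)  (b ∷ A) (suc a) = lookup-embed-ι p A a
lookup-embed-ι (false ∷ p) A       a       = lookup-embed-ι p A a

lookup-embed-∉ : (p : Subset n) (A : Subset ∣ p ∣) {x : Fin n} → x ∉ p → lookup (embed p A) x ≡ false
lookup-embed-∉ (true ∷ p)  (b ∷ A) {zero}  x∉p = contradiction here x∉p
lookup-embed-∉ (true ∷ p)  (b ∷ A) {suc x} x∉p = lookup-embed-∉ p A (x∉p ∘ there)
lookup-embed-∉ (false ∷ p) A       {zero}  x∉p = refl
lookup-embed-∉ (false ∷ p) A       {suc x} x∉p = lookup-embed-∉ p A (x∉p ∘ there)

ι-onto : (p : Subset n) {x : Fin n} → x ∈ p → ∃ λ a → ι p a ≡ x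
ι-onto (true ∷ p)  here        = zero , refl
ι-onto (true ∷ p)  (there x∈p) = let a , ιa≡x = ι-onto p x∈p in suc a , cong suc ιa≡x
ι-onto (false ∷ p) (there x∈p) = let a , ιa≡x = ι-onto p x∈p in a , cong suc ιa≡x

embed-⊥ : (p : Subset n) → embed p ⊥ ≡ ⊥
embed-⊥ []          = refl
embed-⊥ (true ∷ p)  = cong (false ∷_) (embed-⊥ p)
embed-⊥ (false ∷ p) = cong (false ∷_) (embed-⊥ p)

embed-∪ : (p : Subset n) (A B : Subset ∣ p ∣) → embed p (A ∪ B) ≡ embed p A ∪ embed p B
embed-∪ []          []      []      = refl
embed-∪ (true ∷ p)  (a ∷ A) (b ∷ B) = cong ((a ∨ b) ∷_) (embed-∪ p A B)
embed-∪ (false ∷ p) A       B       = cong (false ∷_) (embed-∪ p A B)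

embed-⁅⁆ : (p : Subset n) (a : Fin ∣ p ∣) → embed p ⁅ a ⁆ ≡ ⁅ ι p a ⁆
embed-⁅⁆ (true ∷ p)  zero    = cong (true ∷_) (embed-⊥ p)
embed-⁅⁆ (true ∷ p)  (suc a) = cong (false ∷_) (embed-⁅⁆ p a)
embed-⁅⁆ (false ∷ p) a       = cong (false ∷_) (embed-⁅⁆ p a)

pairCount-++ : (A B : List (Subset n)) (x y : Fin n) → pairCount (A ++ B) x y ≡ pairCount A x y + pairCount B x y
pairCount-++ A B x y = ∑ˡ-++ A B _

pairCount-embed-ι : (p : Subset n) (B : List (Subset ∣ p ∣)) (a b : Fin ∣ p ∣) →
                    pairCount (map (embed p) B) (ι p a) (ι p b) ≡ pairCount B a b
pairCount-embed-ι p B a b = trans (∑ˡ-map (embed p) B _) (∑ˡ-cong B λ A →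
  cong₂ (λ s t → χ (s ∧ t)) (lookup-embed-ι p A a) (lookup-embed-ι p A b))

pairCount-embed-∉ : (p : Subset n) (B : List (Subset ∣ p ∣)) {x y : Fin n} → x ∉ p ⊎ y ∉ p →
                    pairCount (map (embed p) B) x y ≡ 0
pairCount-embed-∉ p B {x} {y} outside = trans (∑ˡ-map (embed p) B _) (∑ˡ-zero (All.universal (uncovered outside) B))
  where
  uncovered : x ∉ p ⊎ y ∉ p → ∀ A → χ (lookup (embed p A) x ∧ lookup (embed p A) y) ≡ 0
  uncovered (inj₁ x∉p) A rewrite lookup-embed-∉ p A x∉p = refl
  uncovered (inj₂ y∉p) A rewrite lookup-embed-∉ p A y∉p = cong χ (∧-zeroʳ _)

-- Developments of families of blocks

map-commute : {f : B → C} {g : A → B} {h : D → C} {k : A → D} →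
              (∀ x → f (g x) ≡ h (k x)) → ∀ xs → map f (map g xs) ≡ map h (map k xs)
map-commute fg≗hk xs = trans (sym (map-∘ xs)) (trans (map-cong fg≗hk xs) (map-∘ xs))

develop : (Fin n → A → A) → (Fin n → Bool) → List A → List A
develop {n = n} act R xs = concatMap (λ g → if R g then map (act g) xs else []) (List.allFin n)

∑ˡ-develop : (act : Fin n → A → A) (R : Fin n → Bool) (xs : List A) (f : A → ℕ) →
             ∑ˡ (develop act R xs) f ≡ ∑[ g < n ] (if R g then ∑ˡ xs (f ∘ act g) else 0)
∑ˡ-develop {n = n} act R xs f = begin
  ∑ˡ (develop act R xs) f
    ≡⟨ ∑ˡ-concatMap _ (List.allFin n) f ⟩
  ∑ˡ (List.allFin n) (λ g → ∑ˡ (if R g then map (act g) xs else []) f)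
    ≡⟨ ∑ˡ-tabulate {n = n} (λ g → g) _ ⟩
  ∑[ g < n ] ∑ˡ (if R g then map (act g) xs else []) f
    ≡⟨ sum-cong-≗ (λ g → trans (if-float (λ ys → ∑ˡ ys f) (R g))
                                (cong (λ s → if R g then s else 0) (∑ˡ-map (act g) xs f))) ⟩
  ∑[ g < n ] (if R g then ∑ˡ xs (f ∘ act g) else 0) ∎
  where open ≡-Reasoning

map-develop : (f : A → B) {act : Fin n → A → A} {act′ : Fin n → B → B} →
              (∀ g x → f (act g x) ≡ act′ g (f x)) →
              ∀ R xs → map f (develop act R xs) ≡ develop act′ R (map f xs)
map-develop {n = n} f {act} {act′} equivariant R xs =
  trans (map-concatMap f _ (List.allFin n)) (concatMap-cong translates (List.allFin n))
  where
  translates : ∀ g → map f (if R g then map (act g) xs else []) ≡ (if R g then map (act′ g) (map f xs) else [])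
  translates g with R g
  ... | true  = map-commute (equivariant g) xs
  ... | false = refl

All-develop : {P : A → Set ℓ′} (act : Fin n → A → A) (R : Fin n → Bool) →
              (∀ g {x} → P x → P (act g x)) → {xs : List A} → All P xs → All P (develop act R xs)
All-develop {P = P} act R preserves {xs} Pxs = concat⁺ (map⁺ (tabulate⁺ translates))
  where
  translates : ∀ g → All P (if R g then map (act g) xs else [])
  translates g with R g
  ... | true  = map⁺ (All.map (preserves g) Pxs)
  ... | false = []

augment : Subset n × Fin n → Subset n
augment p = proj₁ p ∪ ⁅ proj₂ p ⁆

embedᵖ : (p : Subset n) → Subset ∣ p ∣ × Fin ∣ p ∣ → Subset n × Fin n
embedᵖ p (A , a) = embed p A , ι p a

augment-embedᵖ : (p : Subset n) (q : Subset ∣ p ∣ × Fin ∣ p ∣) → augment (embedᵖ p q) ≡ embed p (augment q)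
augment-embedᵖ p (A , a) = sym (trans (embed-∪ p A ⁅ a ⁆) (cong (embed p A ∪_) (embed-⁅⁆ p a)))

module Translates {v : ℕ} (G : FinAbGroup v) where

  open FinAbGroup G using () renaming (_+_ to _+ᴳ_; _-_ to _-ᴳ_; -_ to -ᴳ_; 0# to 0ᴳ)

  abelianGroup : AbelianGroup 0ℓ 0ℓ
  abelianGroup = record { isAbelianGroup = FinAbGroup.isAbelianGroup G }

  open AbelianGroup abelianGroup using (assoc; comm; identityˡ; inverseˡ; inverseʳ)
  open import Algebra.Properties.AbelianGroup abelianGroup
    using (⁻¹-anti-homo‿-; x∙y⁻¹≈ε⇒x≈y; //-rightDividesˡ; //-rightDividesʳ; ∙-cancelʳ)

  x-[x-y]≡y : ∀ x y → x -ᴳ (x -ᴳ y) ≡ y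
  x-[x-y]≡y x y = begin
    x +ᴳ -ᴳ (x -ᴳ y)  ≡⟨ cong (x +ᴳ_) (⁻¹-anti-homo‿- x y) ⟩
    x +ᴳ (y -ᴳ x)     ≡⟨ comm x (y -ᴳ x) ⟩
    (y -ᴳ x) +ᴳ x     ≡⟨ //-rightDividesˡ x y ⟩
    y                 ∎
    where open ≡-Reasoning

  y-[x-a]≡a-[x-y] : ∀ x y a → y -ᴳ (x -ᴳ a) ≡ a -ᴳ (x -ᴳ y)
  y-[x-a]≡a-[x-y] x y a = begin
    y +ᴳ -ᴳ (x -ᴳ a)     ≡⟨ cong (y +ᴳ_) (⁻¹-anti-homo‿- x a) ⟩
    y +ᴳ (a +ᴳ -ᴳ x)     ≡⟨ assoc y a (-ᴳ x) ⟨
    (y +ᴳ a) +ᴳ -ᴳ x     ≡⟨ cong (_+ᴳ -ᴳ x) (comm y a) ⟩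
    (a +ᴳ y) +ᴳ -ᴳ x     ≡⟨ assoc a y (-ᴳ x) ⟩
    a +ᴳ (y -ᴳ x)        ≡⟨ cong (a +ᴳ_) (⁻¹-anti-homo‿- x y) ⟨
    a +ᴳ -ᴳ (x -ᴳ y)     ∎
    where open ≡-Reasoning

  [x-y]+[y-z]≡x-z : ∀ x y z → (x -ᴳ y) +ᴳ (y -ᴳ z) ≡ x -ᴳ z
  [x-y]+[y-z]≡x-z x y z = begin
    (x +ᴳ -ᴳ y) +ᴳ (y -ᴳ z)   ≡⟨ assoc x (-ᴳ y) (y -ᴳ z) ⟩
    x +ᴳ (-ᴳ y +ᴳ (y -ᴳ z))   ≡⟨ cong (x +ᴳ_) (assoc (-ᴳ y) y (-ᴳ z)) ⟨
    x +ᴳ ((-ᴳ y +ᴳ y) -ᴳ z)   ≡⟨ cong (λ e → x +ᴳ (e -ᴳ z)) (inverseˡ y) ⟩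
    x +ᴳ (0ᴳ -ᴳ z)            ≡⟨ cong (x +ᴳ_) (identityˡ (-ᴳ z)) ⟩
    x -ᴳ z                    ∎
    where open ≡-Reasoning

  x-y≡0⇔x≡y : ∀ {x y} → x -ᴳ y ≡ 0ᴳ ⇔ x ≡ y
  x-y≡0⇔x≡y {x} = mk⇔ (x∙y⁻¹≈ε⇒x≈y _ _) (λ { refl → inverseʳ x })

  x≢y⇒x-y≢0 : ∀ {x y} → x ≢ y → x -ᴳ y ≢ 0ᴳ
  x≢y⇒x-y≢0 x≢y = x≢y ∘ Equivalence.to x-y≡0⇔x≡y

  x-g≡y-g⇒x≡y : ∀ {x y g} → x -ᴳ g ≡ y -ᴳ g → x ≡ y
  x-g≡y-g⇒x≡y = ∙-cancelʳ _ _ _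

  x-g≡s⇔x≡g+s : ∀ {x g s} → x -ᴳ g ≡ s ⇔ x ≡ g +ᴳ s
  x-g≡s⇔x≡g+s {x} {g} {s} = mk⇔
    (λ x-g≡s → trans (sym (//-rightDividesˡ g x)) (trans (cong (_+ᴳ g) x-g≡s) (comm s g)))
    (λ x≡g+s → trans (cong (_-ᴳ g) (trans x≡g+s (comm g s))) (//-rightDividesʳ g s))

  shift : Fin v → Subset v → Subset v
  shift g S = tabulate (λ x → lookup S (x -ᴳ g))

  lookup-shift : ∀ g S x → lookup (shift g S) x ≡ lookup S (x -ᴳ g)
  lookup-shift g S = lookup∘tabulate _

  shift-≡ : ∀ g S {T} → (∀ x → lookup S (x -ᴳ g) ≡ lookup T x) → shift g S ≡ T
  shift-≡ g S {T} eq = trans (tabulate-cong eq) (tabulate∘lookup T)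

  shift-∪ : ∀ g S T → shift g (S ∪ T) ≡ shift g S ∪ shift g T
  shift-∪ g S T = shift-≡ g (S ∪ T) λ x → begin
    lookup (S ∪ T) (x -ᴳ g)                       ≡⟨ lookup-zipWith _∨_ (x -ᴳ g) S T ⟩
    lookup S (x -ᴳ g) ∨ lookup T (x -ᴳ g)         ≡⟨ cong₂ _∨_ (lookup-shift g S x) (lookup-shift g T x) ⟨
    lookup (shift g S) x ∨ lookup (shift g T) x   ≡⟨ lookup-zipWith _∨_ x (shift g S) (shift g T) ⟨
    lookup (shift g S ∪ shift g T) x              ∎
    where open ≡-Reasoning

  shift-⁅⁆ : ∀ g s → shift g ⁅ s ⁆ ≡ ⁅ g +ᴳ s ⁆
  shift-⁅⁆ g s = shift-≡ g ⁅ s ⁆ λ x →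
    trans (lookup-⁅⁆ (x -ᴳ g) s) (trans (eqᵇ-cong x-g≡s⇔x≡g+s) (sym (lookup-⁅⁆ x (g +ᴳ s))))

  ∣shift∣ : ∀ g S → ∣ shift g S ∣ ≡ ∣ S ∣
  ∣shift∣ g S = begin
    ∣ shift g S ∣                  ≡⟨ ∣tabulate∣≡∑χ (lookup S ∘ (_-ᴳ g)) ⟩
    ∑ (χ ∘ lookup S ∘ (_-ᴳ g))     ≡⟨ ∑-reindex (χ ∘ lookup S) (_-ᴳ g) (_+ᴳ g) (//-rightDividesʳ g) (//-rightDividesˡ g) ⟩
    ∑ (χ ∘ lookup S)               ≡⟨ ∣p∣≡∑χ S ⟨
    ∣ S ∣                          ∎
    where open ≡-Reasoning

  diffCountBlock≡∑ : (S : Subset v) {d : Fin v} → d ≢ 0ᴳ →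
                     diffCountBlock G S d ≡ ∑[ a < v ] χ (lookup S a ∧ lookup S (a -ᴳ d))
  diffCountBlock≡∑ S {d} d≢0 = begin
    diffCountBlock G S d                            ≡⟨ ∑ˡ-tabulate {n = v} (λ a → a) _ ⟩
    ∑[ a < v ] ∣ tabulate (diffPair a) ∣            ≡⟨ sum-cong-≗ (∣tabulate∣≡∑χ ∘ diffPair) ⟩
    ∑[ a < v ] ∑[ b < v ] χ (diffPair a b)          ≡⟨ sum-cong-≗ (λ a → ∑-single (a -ᴳ d) (nonPartner a)) ⟩
    ∑[ a < v ] χ (diffPair a (a -ᴳ d))              ≡⟨ sum-cong-≗ (cong χ ∘ partner) ⟩
    ∑[ a < v ] χ (lookup S a ∧ lookup S (a -ᴳ d))   ∎
    where
    open ≡-Reasoning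
    diffPair : Fin v → Fin v → Bool
    diffPair a b = lookup S a ∧ lookup S b ∧ not (eqᵇ a b) ∧ eqᵇ (a -ᴳ b) d

    nonPartner : ∀ a b → b ≢ a -ᴳ d → χ (diffPair a b) ≡ 0
    nonPartner a b b≢a-d
      rewrite eqᵇ-≢ (λ a-b≡d → b≢a-d (trans (sym (x-[x-y]≡y a b)) (cong (λ e → a -ᴳ e) a-b≡d)))
            | ∧-zeroʳ (not (eqᵇ a b)) | ∧-zeroʳ (lookup S b) | ∧-zeroʳ (lookup S a) = refl

    a≢a-d : ∀ a → a ≢ a -ᴳ d
    a≢a-d a a≡a-d = d≢0 (trans (sym (x-[x-y]≡y a d)) (trans (cong (λ e → a -ᴳ e) (sym a≡a-d)) (inverseʳ a)))

    partner : ∀ a → diffPair a (a -ᴳ d) ≡ lookup S a ∧ lookup S (a -ᴳ d)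
    partner a rewrite x-[x-y]≡y a d | eqᵇ-refl d | eqᵇ-≢ (a≢a-d a) = cong (lookup S a ∧_) (∧-identityʳ _)

  ∑-translates≡diffCountBlock : (S : Subset v) {x y : Fin v} → x ≢ y →
    ∑[ g < v ] χ (lookup S (x -ᴳ g) ∧ lookup S (y -ᴳ g)) ≡ diffCountBlock G S (x -ᴳ y)
  ∑-translates≡diffCountBlock S {x} {y} x≢y = begin
    ∑[ g < v ] χ (lookup S (x -ᴳ g) ∧ lookup S (y -ᴳ g))
      ≡⟨ ∑-reindex _ (λ e → x -ᴳ e) (λ e → x -ᴳ e) (x-[x-y]≡y x) (x-[x-y]≡y x) ⟨
    ∑[ a < v ] χ (lookup S (x -ᴳ (x -ᴳ a)) ∧ lookup S (y -ᴳ (x -ᴳ a)))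
      ≡⟨ sum-cong-≗ (λ a → cong₂ (λ b c → χ (lookup S b ∧ lookup S c)) (x-[x-y]≡y x a) (y-[x-a]≡a-[x-y] x y a)) ⟩
    ∑[ a < v ] χ (lookup S a ∧ lookup S (a -ᴳ (x -ᴳ y)))
      ≡⟨ diffCountBlock≡∑ S (x≢y⇒x-y≢0 x≢y) ⟨
    diffCountBlock G S (x -ᴳ y)
      ∎
    where open ≡-Reasoning

  diffCountBlock-∪⁅0⁆-≤ : (S : Subset v) {d : Fin v} → d ≢ 0ᴳ →
    diffCountBlock G (S ∪ ⁅ 0ᴳ ⁆) d ≤ diffCountBlock G S d + occurrences d (S ∷ negSet G S ∷ [])
  diffCountBlock-∪⁅0⁆-≤ S {d} d≢0 = begin
    diffCountBlock G (S ∪ ⁅ 0ᴳ ⁆) d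
      ≡⟨ diffCountBlock≡∑ (S ∪ ⁅ 0ᴳ ⁆) d≢0 ⟩
    ∑[ a < v ] χ (lookup (S ∪ ⁅ 0ᴳ ⁆) a ∧ lookup (S ∪ ⁅ 0ᴳ ⁆) (a -ᴳ d))
      ≤⟨ ∑-mono bound ⟩
    ∑[ a < v ] (differences a + (endsAtD a + startsAt0 a))
      ≡⟨ trans (∑-distrib-+ differences _) (cong (∑ differences +_) (∑-distrib-+ endsAtD startsAt0)) ⟩
    ∑ differences + (∑ endsAtD + ∑ startsAt0)
      ≡⟨ cong₂ _+_ (sym (diffCountBlock≡∑ S d≢0))
                   (cong₂ _+_ (∑-χ-eqᵇ-∧ d (lookup S)) (∑-χ-eqᵇ-∧ 0ᴳ (λ a → lookup S (a -ᴳ d)))) ⟩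
    diffCountBlock G S d + (χ (lookup S d) + χ (lookup S (0ᴳ -ᴳ d)))
      ≡⟨ cong (λ e → diffCountBlock G S d + (χ (lookup S d) + e)) (sym (trans (+-identityʳ _) (cong χ negSet-d))) ⟩
    diffCountBlock G S d + occurrences d (S ∷ negSet G S ∷ [])
      ∎
    where
    open ≤-Reasoning
    negSet-d : lookup (negSet G S) d ≡ lookup S (0ᴳ -ᴳ d)
    negSet-d = trans (lookup∘tabulate _ d) (cong (lookup S) (sym (identityˡ (-ᴳ d))))

    lookup-∪⁅0⁆ : ∀ a → lookup (S ∪ ⁅ 0ᴳ ⁆) a ≡ lookup S a ∨ eqᵇ a 0ᴳ
    lookup-∪⁅0⁆ a = trans (lookup-zipWith _∨_ a S ⁅ 0ᴳ ⁆) (cong (lookup S a ∨_) (lookup-⁅⁆ a 0ᴳ))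

    not-both-0 : ∀ a → eqᵇ a 0ᴳ ∧ eqᵇ (a -ᴳ d) 0ᴳ ≡ false
    not-both-0 a with a ≟ 0ᴳ
    ... | no _     = refl
    ... | yes refl = eqᵇ-≢ (λ 0-d≡0 → d≢0 (sym (Equivalence.to x-y≡0⇔x≡y 0-d≡0)))

    differences endsAtD startsAt0 : Fin v → ℕ
    differences a = χ (lookup S a ∧ lookup S (a -ᴳ d))
    endsAtD     a = χ (eqᵇ a d ∧ lookup S a)
    startsAt0   a = χ (eqᵇ a 0ᴳ ∧ lookup S (a -ᴳ d))

    bound : ∀ a → χ (lookup (S ∪ ⁅ 0ᴳ ⁆) a ∧ lookup (S ∪ ⁅ 0ᴳ ⁆) (a -ᴳ d))
                ≤ differences a + (endsAtD a + startsAt0 a)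
    bound a rewrite lookup-∪⁅0⁆ a | lookup-∪⁅0⁆ (a -ᴳ d)
                  | sym (eqᵇ-cong {x = a -ᴳ d} {0ᴳ} {a} {d} x-y≡0⇔x≡y) =
      χ-∨∧∨≤ (lookup S a) (lookup S (a -ᴳ d)) (eqᵇ a 0ᴳ) (eqᵇ (a -ᴳ d) 0ᴳ) (not-both-0 a)

  pairCount-develop : (R : Fin v → Bool) (A : List (Subset v)) (x y : Fin v) →
    pairCount (develop shift R A) x y ≡ ∑[ g < v ] (if R g then pairCount A (x -ᴳ g) (y -ᴳ g) else 0)
  pairCount-develop R A x y = trans (∑ˡ-develop shift R A _) (sum-cong-≗ λ g →
    cong (λ c → if R g then c else 0) (∑ˡ-cong A λ S →
      cong₂ (λ b c → χ (b ∧ c)) (lookup-shift g S x) (lookup-shift g S y)))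

  development : List (Subset v) → List (Subset v)
  development = develop shift (λ _ → true)

  pairCount-development : (A : List (Subset v)) {x y : Fin v} → x ≢ y →
                          pairCount (development A) x y ≡ diffCount G A (x -ᴳ y)
  pairCount-development A {x} {y} x≢y = begin
    pairCount (development A) x y
      ≡⟨ pairCount-develop _ A x y ⟩
    ∑[ g < v ] pairCount A (x -ᴳ g) (y -ᴳ g)
      ≡⟨ ∑ˡ-∑ {n = v} A _ ⟨
    ∑ˡ A (λ S → ∑[ g < v ] χ (lookup S (x -ᴳ g) ∧ lookup S (y -ᴳ g)))
      ≡⟨ ∑ˡ-cong A (λ S → ∑-translates≡diffCountBlock S x≢y) ⟩
    diffCount G A (x -ᴳ y)
      ∎
    where open ≡-Reasoning

  ∈negSet⇒-∈ : ∀ {S d} → d ∈ negSet G S → -ᴳ d ∈ S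
  ∈negSet⇒-∈ {S} {d} d∈-S = lookup⇒[]= (-ᴳ d) S (trans (sym (lookup∘tabulate _ d)) ([]=⇒lookup d∈-S))

  signedBlocks : List (Subset v) → List (Subset v)
  signedBlocks = concatMap (λ B → B ∷ negSet G B ∷ [])

  diffCount-∪⁅0⁆-≤ : (F : List (Subset v)) {d : Fin v} → d ≢ 0ᴳ →
    diffCount G (map (_∪ ⁅ 0ᴳ ⁆) F) d ≤ diffCount G F d + occurrences d (signedBlocks F)
  diffCount-∪⁅0⁆-≤ F {d} d≢0 = begin
    diffCount G (map (_∪ ⁅ 0ᴳ ⁆) F) d
      ≡⟨ ∑ˡ-map _ F _ ⟩
    ∑ˡ F (λ S → diffCountBlock G (S ∪ ⁅ 0ᴳ ⁆) d)
      ≤⟨ ∑ˡ-mono F (λ S → diffCountBlock-∪⁅0⁆-≤ S d≢0) ⟩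
    ∑ˡ F (λ S → diffCountBlock G S d + occurrences d (S ∷ negSet G S ∷ []))
      ≡⟨ ∑ˡ-+ F _ _ ⟩
    diffCount G F d + ∑ˡ F (λ S → occurrences d (S ∷ negSet G S ∷ []))
      ≡⟨ cong (diffCount G F d +_) (∑ˡ-concatMap _ F _) ⟨
    diffCount G F d + occurrences d (signedBlocks F)
      ∎
    where open ≤-Reasoning

  All-IsKSubset-develop : ∀ {k} R {A} → All (IsKSubset k) A → All (IsKSubset k) (develop shift R A)
  All-IsKSubset-develop R = All-develop shift R (λ g {S} → trans (∣shift∣ g S))

  translate : Fin v → Subset v × Fin v → Subset v × Fin v
  translate g (S , s) = shift g S , g +ᴳ s

  augment-translate : ∀ g p → augment (translate g p) ≡ shift g (augment p)
  augment-translate g (S , s) = sym (trans (shift-∪ g S ⁅ s ⁆) (cong (shift g S ∪_) (shift-⁅⁆ g s)))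

  map-proj₁-develop : ∀ R P → map proj₁ (develop translate R P) ≡ develop shift R (map proj₁ P)
  map-proj₁-develop = map-develop proj₁ (λ _ _ → refl)

  map-augment-develop : ∀ R P → map augment (develop translate R P) ≡ develop shift R (map augment P)
  map-augment-develop = map-develop augment augment-translate

module CosetCopies {v : ℕ} (G : FinAbGroup v) (H : Subset v) (H≤G : IsSubgroup G H) where

  open FinAbGroup G using () renaming (_+_ to _+ᴳ_; _-_ to _-ᴳ_; -_ to -ᴳ_; 0# to 0ᴳ)
  open Translates G
  open AbelianGroup abelianGroup using (inverseʳ)
  open import Algebra.Properties.AbelianGroup abelianGroup using (⁻¹-anti-homo‿-)
  open IsSubgroup H≤G

  sameCoset-refl : ∀ x → x -ᴳ x ∈ H
  sameCoset-refl x = subst (_∈ H) (sym (inverseʳ x)) zero-∈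

  sameCoset-sym : ∀ {x y} → x -ᴳ y ∈ H → y -ᴳ x ∈ H
  sameCoset-sym {x} {y} = subst (_∈ H) (⁻¹-anti-homo‿- x y) ∘ neg-closed

  sameCoset-trans : ∀ {x y z} → x -ᴳ y ∈ H → y -ᴳ z ∈ H → x -ᴳ z ∈ H
  sameCoset-trans {x} {y} {z} x-y∈H y-z∈H = subst (_∈ H) ([x-y]+[y-z]≡x-z x y z) (+-closed x-y∈H y-z∈H)

  cosetMin : Fin v → Fin v
  cosetMin x = Maybe.fromMaybe x (first (λ z → z -ᴳ x ∈? H))

  first≡cosetMin : ∀ x → first (λ z → z -ᴳ x ∈? H) ≡ just (cosetMin x)
  first≡cosetMin x with first (λ z → z -ᴳ x ∈? H) | first-complete (λ z → z -ᴳ x ∈? H) (sameCoset-refl x)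
  ... | just _  | _      = refl
  ... | nothing | _ , ()

  cosetMin-∈ : ∀ x → cosetMin x -ᴳ x ∈ H
  cosetMin-∈ x = first-sound (λ z → z -ᴳ x ∈? H) (first≡cosetMin x)

  x-cosetMin∈H : ∀ x → x -ᴳ cosetMin x ∈ H
  x-cosetMin∈H x = sameCoset-sym (cosetMin-∈ x)

  cosetMin-cong : ∀ {x y} → x -ᴳ y ∈ H → cosetMin x ≡ cosetMin y
  cosetMin-cong {x} {y} x-y∈H = just-injective (begin
    just (cosetMin x)             ≡⟨ first≡cosetMin x ⟨
    first (λ z → z -ᴳ x ∈? H)     ≡⟨ first-cong _ _ (λ z → mk⇔ (λ z-x∈H → sameCoset-trans z-x∈H x-y∈H)
                                                               (λ z-y∈H → sameCoset-trans z-y∈H (sameCoset-sym x-y∈H))) ⟩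
    first (λ z → z -ᴳ y ∈? H)     ≡⟨ first≡cosetMin y ⟩
    just (cosetMin y)             ∎)
    where open ≡-Reasoning

  isCosetMin : Fin v → Bool
  isCosetMin g = does (cosetMin g ≟ g)

  ∑-cosetMin : (x : Fin v) (f : Fin v → ℕ) → (∀ g → x -ᴳ g ∉ H → f g ≡ 0) →
               ∑[ g < v ] (if isCosetMin g then f g else 0) ≡ f (cosetMin x)
  ∑-cosetMin x f vanish = trans (∑-single (cosetMin x) others)
    (cong (λ b → if b then f (cosetMin x) else 0) (dec-true (_ ≟ _) (cosetMin-cong (cosetMin-∈ x))))
    where
    others : ∀ g → g ≢ cosetMin x → (if isCosetMin g then f g else 0) ≡ 0
    others g g≢μx with cosetMin g ≟ g
    ... | no _     = refl
    ... | yes μg≡g = vanish g (λ x-g∈H → g≢μx (trans (sym μg≡g) (cosetMin-cong (sameCoset-sym x-g∈H))))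

  cosetCopies : List (Subset ∣ H ∣) → List (Subset v)
  cosetCopies B = develop shift isCosetMin (map (embed H) B)

  pairCount-cosetCopies : (B : List (Subset ∣ H ∣)) (x y : Fin v) →
    pairCount (cosetCopies B) x y ≡ pairCount (map (embed H) B) (x -ᴳ cosetMin x) (y -ᴳ cosetMin x)
  pairCount-cosetCopies B x y = trans (pairCount-develop isCosetMin _ x y)
    (∑-cosetMin x _ (λ g x-g∉H → pairCount-embed-∉ H B (inj₁ x-g∉H)))

  pairCount-cosetCopies-∉ : (B : List (Subset ∣ H ∣)) {x y : Fin v} → x -ᴳ y ∉ H → pairCount (cosetCopies B) x y ≡ 0
  pairCount-cosetCopies-∉ B {x} {y} x-y∉H = trans (pairCount-cosetCopies B x y) (pairCount-embed-∉ H B (inj₂ λ y-μx∈H →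
    x-y∉H (sameCoset-trans (x-cosetMin∈H x) (sameCoset-sym y-μx∈H))))

  pairCount-cosetCopies-∈ : (B : List (Subset ∣ H ∣)) {x y : Fin v} → x ≢ y → x -ᴳ y ∈ H →
    ∃₂ λ a b → a ≢ b × pairCount (cosetCopies B) x y ≡ pairCount B a b
  pairCount-cosetCopies-∈ B {x} {y} x≢y x-y∈H
    with ι-onto H (x-cosetMin∈H x) | ι-onto H (sameCoset-trans (sameCoset-sym x-y∈H) (x-cosetMin∈H x))
  ... | a , ιa≡x-μx | b , ιb≡y-μx =
    a , b , (λ a≡b → x≢y (x-g≡y-g⇒x≡y (trans (sym ιa≡x-μx) (trans (cong (ι H) a≡b) ιb≡y-μx)))) , (begin
      pairCount (cosetCopies B) x y
        ≡⟨ pairCount-cosetCopies B x y ⟩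
      pairCount (map (embed H) B) (x -ᴳ cosetMin x) (y -ᴳ cosetMin x)
        ≡⟨ cong₂ (pairCount (map (embed H) B)) ιa≡x-μx ιb≡y-μx ⟨
      pairCount (map (embed H) B) (ι H a) (ι H b)
        ≡⟨ pairCount-embed-ι H B a b ⟩
      pairCount B a b
        ∎)
    where open ≡-Reasoning

  All-IsKSubset-cosetCopies : ∀ {k B} → All (IsKSubset k) B → All (IsKSubset k) (cosetCopies B)
  All-IsKSubset-cosetCopies sizes = All-IsKSubset-develop isCosetMin (map⁺ (All.map (λ {A} → trans (∣embed∣ H A)) sizes))

  isBIBD-development++cosetCopies : ∀ {k F B} → IsRDF G H k 1 F → IsBIBD ∣ H ∣ k 1 B →
                                    IsBIBD v k 1 (development F ++ cosetCopies B)
  isBIBD-development++cosetCopies {F = F} {B} (F-sizes , F-diffs) (B-sizes , B-pairs) =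
    ++⁺ (All-IsKSubset-develop _ F-sizes) (All-IsKSubset-cosetCopies B-sizes) , pairs
    where
    pairs : ∀ x y → x ≢ y → pairCount (development F ++ cosetCopies B) x y ≡ 1
    pairs x y x≢y with x -ᴳ y ∈? H
    ... | yes x-y∈H =
      let a , b , a≢b , copies≡ = pairCount-cosetCopies-∈ B x≢y x-y∈H in
      trans (pairCount-++ (development F) (cosetCopies B) x y)
            (cong₂ _+_ (trans (pairCount-development F x≢y) (proj₁ (F-diffs _) x-y∈H)) (trans copies≡ (B-pairs a b a≢b)))
    ... | no x-y∉H =
      trans (pairCount-++ (development F) (cosetCopies B) x y)
            (cong₂ _+_ (trans (pairCount-development F x≢y) (proj₂ (F-diffs _) x-y∉H)) (pairCount-cosetCopies-∉ B x-y∉H))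

  occurrences-signedBlocks-∈H : ∀ {F d} → All (λ S → Empty (S ∩ H)) F → d ∈ H → occurrences d (signedBlocks F) ≡ 0
  occurrences-signedBlocks-∈H {F} {d} F-avoids-H d∈H = trans (∑ˡ-concatMap _ F _) (∑ˡ-zero (All.map absent F-avoids-H))
    where
    absent : ∀ {S} → Empty (S ∩ H) → occurrences d (S ∷ negSet G S ∷ []) ≡ 0
    absent {S} S∩H=∅ = occurrences-absent (S ∷ negSet G S ∷ []) λ
      { zero       d∈S  → S∩H=∅ (d , x∈p∩q⁺ (d∈S , d∈H))
      ; (suc zero) d∈-S → S∩H=∅ (-ᴳ d , x∈p∩q⁺ (∈negSet⇒-∈ d∈-S , neg-closed d∈H)) }

  isPartialBIBD-development++cosetCopies : ∀ {k F B} → IsBRDF G H k 1 F → IsPartialBIBD ∣ H ∣ (suc k) 2 B →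
                                           IsPartialBIBD v (suc k) 2 (development (map (_∪ ⁅ 0ᴳ ⁆) F) ++ cosetCopies B)
  isPartialBIBD-development++cosetCopies {k} {F} {B}
    ((F-sizes , F-diffs) , F-avoids-H , F-signed-disjoint) (B-sizes , B-pairs) =
    ++⁺ (All-IsKSubset-develop _ (map⁺ (All.map augmentedSize (All.zip (F-sizes , F-avoids-H)))))
        (All-IsKSubset-cosetCopies B-sizes) , pairs
    where
    augmentedSize : ∀ {S} → IsKSubset k S × Empty (S ∩ H) → IsKSubset (suc k) (S ∪ ⁅ 0ᴳ ⁆)
    augmentedSize {S} (size , S∩H=∅) =
      trans (x∉p⇒∣p∪⁅x⁆∣≡1+∣p∣ S (λ 0∈S → S∩H=∅ (0ᴳ , x∈p∩q⁺ (0∈S , zero-∈)))) (cong suc size)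

    pairs : ∀ x y → x ≢ y → pairCount (development (map (_∪ ⁅ 0ᴳ ⁆) F) ++ cosetCopies B) x y ≤ 2
    pairs x y x≢y with x -ᴳ y ∈? H
    ... | yes x-y∈H =
      let a , b , a≢b , copies≡ = pairCount-cosetCopies-∈ B x≢y x-y∈H in begin
      pairCount (development (map (_∪ ⁅ 0ᴳ ⁆) F) ++ cosetCopies B) x y
        ≡⟨ pairCount-++ (development (map (_∪ ⁅ 0ᴳ ⁆) F)) (cosetCopies B) x y ⟩
      pairCount (development (map (_∪ ⁅ 0ᴳ ⁆) F)) x y + pairCount (cosetCopies B) x y
        ≡⟨ cong₂ _+_ (pairCount-development _ x≢y) copies≡ ⟩
      diffCount G (map (_∪ ⁅ 0ᴳ ⁆) F) (x -ᴳ y) + pairCount B a b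
        ≤⟨ +-mono-≤ (diffCount-∪⁅0⁆-≤ F (x≢y⇒x-y≢0 x≢y)) (B-pairs a b a≢b) ⟩
      diffCount G F (x -ᴳ y) + occurrences (x -ᴳ y) (signedBlocks F) + 2
        ≡⟨ cong (_+ 2) (cong₂ _+_ (proj₁ (F-diffs _) x-y∈H) (occurrences-signedBlocks-∈H F-avoids-H x-y∈H)) ⟩
      2 ∎
      where open ≤-Reasoning
    ... | no x-y∉H = begin
      pairCount (development (map (_∪ ⁅ 0ᴳ ⁆) F) ++ cosetCopies B) x y
        ≡⟨ pairCount-++ (development (map (_∪ ⁅ 0ᴳ ⁆) F)) (cosetCopies B) x y ⟩
      pairCount (development (map (_∪ ⁅ 0ᴳ ⁆) F)) x y + pairCount (cosetCopies B) x y
        ≡⟨ cong₂ _+_ (pairCount-development _ x≢y) (pairCount-cosetCopies-∉ B x-y∉H) ⟩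
      diffCount G (map (_∪ ⁅ 0ᴳ ⁆) F) (x -ᴳ y) + 0
        ≤⟨ +-mono-≤ (diffCount-∪⁅0⁆-≤ F (x≢y⇒x-y≢0 x≢y)) ≤-refl ⟩
      diffCount G F (x -ᴳ y) + occurrences (x -ᴳ y) (signedBlocks F) + 0
        ≤⟨ +-mono-≤ (+-mono-≤ (≤-reflexive (proj₂ (F-diffs _) x-y∉H))
                              (occurrences-disjoint (signedBlocks F) F-signed-disjoint (x -ᴳ y))) ≤-refl ⟩
      2 ∎
      where open ≤-Reasoning

  nestedDesign : List (Subset v) → List (Subset ∣ H ∣ × Fin ∣ H ∣) → List (Subset v × Fin v)
  nestedDesign F Q = develop translate (λ _ → true) (map (_, 0ᴳ) F) ++ develop translate isCosetMin (map (embedᵖ H) Q)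

  map-proj₁-nestedDesign : (F : List (Subset v)) (Q : List (Subset ∣ H ∣ × Fin ∣ H ∣)) →
                           map proj₁ (nestedDesign F Q) ≡ development F ++ cosetCopies (map proj₁ Q)
  map-proj₁-nestedDesign F Q = begin
    map proj₁ (nestedDesign F Q)
      ≡⟨ map-++ proj₁ (develop translate _ (map (_, 0ᴳ) F)) _ ⟩
    map proj₁ (develop translate _ (map (_, 0ᴳ) F)) ++ map proj₁ (develop translate isCosetMin (map (embedᵖ H) Q))
      ≡⟨ cong₂ _++_ (map-proj₁-develop _ (map (_, 0ᴳ) F)) (map-proj₁-develop isCosetMin (map (embedᵖ H) Q)) ⟩
    development (map proj₁ (map (_, 0ᴳ) F)) ++ develop shift isCosetMin (map proj₁ (map (embedᵖ H) Q))
      ≡⟨ cong₂ (λ A B → development A ++ develop shift isCosetMin B)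
               (trans (sym (map-∘ F)) (map-id F)) (map-commute {h = embed H} (λ _ → refl) Q) ⟩
    development F ++ cosetCopies (map proj₁ Q)
      ∎
    where open ≡-Reasoning

  map-augment-nestedDesign : (F : List (Subset v)) (Q : List (Subset ∣ H ∣ × Fin ∣ H ∣)) →
                             map augment (nestedDesign F Q) ≡ development (map (_∪ ⁅ 0ᴳ ⁆) F) ++ cosetCopies (map augment Q)
  map-augment-nestedDesign F Q = begin
    map augment (nestedDesign F Q)
      ≡⟨ map-++ augment (develop translate _ (map (_, 0ᴳ) F)) _ ⟩
    map augment (develop translate _ (map (_, 0ᴳ) F)) ++ map augment (develop translate isCosetMin (map (embedᵖ H) Q))
      ≡⟨ cong₂ _++_ (map-augment-develop _ (map (_, 0ᴳ) F)) (map-augment-develop isCosetMin (map (embedᵖ H) Q)) ⟩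
    development (map augment (map (_, 0ᴳ) F)) ++ develop shift isCosetMin (map augment (map (embedᵖ H) Q))
      ≡⟨ cong₂ (λ A B → development A ++ develop shift isCosetMin B)
               (sym (map-∘ F)) (map-commute {h = embed H} (augment-embedᵖ H) Q) ⟩
    development (map (_∪ ⁅ 0ᴳ ⁆) F) ++ cosetCopies (map augment Q)
      ∎
    where open ≡-Reasoning

lemma4p19 : (v h k : ℕ) (G : FinAbGroup v) (H : Subset v) →
    IsSubgroup G H → ∣ H ∣ ≡ h → 2 ≤ k →
    Σ (List (Subset v)) (IsBRDF G H k 1) →
    NestedBIBD h k 1 →
    NestedBIBD v k 1
lemma4p19 v .(∣ H ∣) k G H H≤G refl _ (F , F-brdf) (Q , Q-blocks , Q-augmented) =
    nestedDesign F Q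
  , subst (IsBIBD v k 1) (sym (map-proj₁-nestedDesign F Q)) (isBIBD-development++cosetCopies (proj₁ F-brdf) Q-blocks)
  , subst (IsPartialBIBD v (suc k) 2) (sym (map-augment-nestedDesign F Q)) (isPartialBIBD-development++cosetCopies F-brdf Q-augmented)
  where open CosetCopies G H H≤G
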